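{- Let $I\triangleleft\mathbf k[x_1,\dots,x_n]$ be a zero-dimensional stable monomial ideal and let $\mathcal B$ be the Bar Code of $\mathsf N(I)$. Then: (a) $l_{n-1}(B^{(n)}_1)>l_{n-1}(B^{(n)}_2)>\dots>l_{n-1}(B^{(n)}_{\mu(n)})$; (b) for every $1\le i\le n-2$ and every $(i+2)$-bar $B^{(i+2)}_j$, if $B^{(i+1)}_{j_1},\dots,B^{(i+1)}_{j_1+h}$ are the $(i+1)$-bars lying over $B^{(i+2)}_j$ (from left to right), then $l_i(B^{(i+1)}_{j_1})>l_i(B^{(i+1)}_{j_1+1})>\dots>l_i(B^{(i+1)}_{j_1+h})$.
   Context: $\mathbf k$ is a field of characteristic $0$; terms of $\mathbf k[x_1,\dots,x_n]$ are ordered lexicographically with $x_1<\dots<x_n$ ($x^\gamma<x^\delta$ iff there is $j$ with $\gamma_j<\delta_j$ and $\gamma_i=\delta_i$ for $i>j$). $\min(\tau)$ is the smallest variable dividing a term $\tau$. A monomial ideal $J$ is stable if for every term $\tau\in J$ and every variable $x_j>\min(\tau)$, $x_j\tau/\min(\tau)\in J$. $\mathsf N(I)$ is the (finite, since $I$ is zero-dimensional) set of terms not in $I$. For $\tau=x_1^{\gamma_1}\cdots x_n^{\gamma_n}$, $P_{x_i}(\tau)=x_i^{\gamma_i}\cdots x_n^{\gamma_n}$. Bar Code of a finite set $M=\{\tau_1<\dots<\tau_m\}$: the $i$-th row is the sequence $P_{x_i}(\tau_1),\dots,P_{x_i}(\tau_m)$; each maximal run of consecutive equal entries (an interval of column indices)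 is an $i$-bar; $B^{(i)}_1,\dots,B^{(i)}_{\mu(i)}$ are the $i$-bars from left to right. A bar of row $i'<i$ lies over a bar of row $i$ if it is contained in it; for a bar $B$ of row $i$ and $k<i$, $l_k(B)$ is the number of $k$-bars lying over $B$. -}

module Defs where

open import Data.Nat using (ℕ; zero; suc; _<_; _≤_; _∸_; pred)
open import Data.Nat using (_≤?_)
import Data.Nat as Nat
open import Data.Fin using (Fin) renaming (_<_ to _<ᶠ_)
open import Data.Vec using (Vec; []; _∷_; lookup; updateAt)
open import Data.Vec.Properties using (≡-dec)
open import Data.List using (List; []; _∷_; map; filter; length)
open import Data.List.Membership.Propositional using (_∈_)
open import Data.List.Relation.Unary.Linked using (Linked)
open import Data.Product using (_×_; _,_)
open import Data.Sum using (_⊎_)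
open import Data.Empty using (⊥)
open import Relation.Nullary using (¬_; Dec; yes; no)
open import Relation.Nullary.Decidable using (_×-dec_)
open import Relation.Binary.PropositionalEquality using (_≡_)

-- A term x_1^{γ_1} ⋯ x_n^{γ_n} is its exponent vector (γ_1, …, γ_n);
-- position 0 of the vector is the variable x_1.
Term : ℕ → Set
Term n = Vec ℕ n

mulVar : ∀ {n} → Fin n → Term n → Term n
mulVar j τ = updateAt τ j suc

-- division by the variable x_{j+1} (used only when x_{j+1} divides τ)
divVar : ∀ {n} → Fin n → Term n → Term n
divVar j τ = updateAt τ j pred

-- Lexicographic order with x_1 < ⋯ < x_n :
-- x^γ < x^δ iff ∃ j, γ_j < δ_j and γ_i = δ_i for all i > j.
_<lex_ : ∀ {n} → Term n → Term n → Set
_<lex_ [] [] = ⊥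
_<lex_ (a ∷ as) (b ∷ bs) = (as <lex bs) ⊎ ((as ≡ bs) × (a < b))

-- A monomial ideal of k[x_1,…,x_n] is determined by (and identified with)
-- the set of terms it contains; this set is closed under multiplication
-- by every variable.
IsMonomialIdeal : ∀ {n} → (Term n → Set) → Set
IsMonomialIdeal {n} I = ∀ (τ : Term n) (j : Fin n) → I τ → I (mulVar j τ)

IsMinVar : ∀ {n} → Term n → Fin n → Set
IsMinVar τ m = (0 < lookup τ m) × (∀ k → k <ᶠ m → lookup τ k ≡ 0)

IsStable : ∀ {n} → (Term n → Set) → Set
IsStable {n} I = ∀ (τ : Term n) (m j : Fin n) → I τ → IsMinVar τ m → m <ᶠ j →
  I (mulVar j (divVar m τ))

-- L is the list of the terms of N(I) = {terms not in I}, listed in strictly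
-- increasing lex order (τ_1 < ⋯ < τ_m).  Existence of such a finite list is
-- exactly zero-dimensionality of the monomial ideal I.
IsSortedN : ∀ {n} → (Term n → Set) → List (Term n) → Set
IsSortedN {n} I L =
  Linked _<lex_ L × (∀ (τ : Term n) → (τ ∈ L → ¬ I τ) × (¬ I τ → τ ∈ L))

-- P_{x_i}(τ) = x_i^{γ_i} ⋯ x_n^{γ_n}  (i is 1-based): zero the first i-1 exponents
zeroFirst : ∀ {n} → ℕ → Term n → Term n
zeroFirst zero v = v
zeroFirst (suc k) [] = []
zeroFirst (suc k) (x ∷ xs) = 0 ∷ zeroFirst k xs

P : ∀ {n} → ℕ → Term n → Term n
P i τ = zeroFirst (i ∸ 1) τ

-- A bar is an interval of column indices [a , b] (0-based, inclusive).
Bar : Set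
Bar = ℕ × ℕ

runsFrom : ∀ {n} → ℕ → ℕ → Term n → List (Term n) → List Bar
runsFrom s c p [] = (s , c) ∷ []
runsFrom s c p (x ∷ xs) with ≡-dec Nat._≟_ p x
... | yes _ = runsFrom s (suc c) x xs
... | no _ = (s , c) ∷ runsFrom (suc c) (suc c) x xs

runs : ∀ {n} → List (Term n) → List Bar
runs [] = []
runs (x ∷ xs) = runsFrom 0 0 x xs

-- i-th row of the Bar Code of L (i is 1-based)
row : ∀ {n} → List (Term n) → ℕ → List (Term n)
row L i = map (P i) L

bars : ∀ {n} → List (Term n) → ℕ → List Bar
bars L i = runs (row L i)

_⊑_ : Bar → Bar → Set
(a , b) ⊑ (c , d) = (c ≤ a) × (b ≤ d)

_⊑?_ : (B C : Bar) → Dec (B ⊑ C)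
(a , b) ⊑? (c , d) = (c ≤? a) ×-dec (b ≤? d)

barsOver : ∀ {n} → List (Term n) → ℕ → Bar → List Bar
barsOver L k B = filter (λ B' → B' ⊑? B) (bars L k)

l : ∀ {n} → List (Term n) → ℕ → Bar → ℕ
l L k B = length (barsOver L k B)

-- Let C ≺ C′ be consecutive (i+1)-bars whose terms share the exponents of x_{i+2}, …, x_n (they
-- lie over one (i+2)-bar, or i = n - 1), so the terms of C have the smaller exponent of x_{i+1}.
-- The i-bars over C are told apart by the exponent of x_i; let E(C) be the set of these exponents,
-- so l_i(C) = |E(C)|. Then 0 ∈ E(C), as N(I) is closed under divisors, and w ∈ E(C′) gives
-- w + 1 ∈ E(C): if σ ∈ N(I) lies in C′ with x_i-exponent w, stability keeps x_i P_i(σ) / x_{i+1}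
-- outside I, and this term is a multiple of x_i^{w+1} P_{i+1}(τ) for τ in C. Hence
-- l_i(C) ≥ l_i(C′) + 1.

module Submission where

open import Defs
open import Data.Nat using (ℕ; zero; suc; _<_; _≤_; _+_; _∸_; pred; z≤n; s≤s; _≤?_; _≟_; >-nonZero)
open import Data.Nat.Properties
open import Data.Fin using (Fin; toℕ; fromℕ<) renaming (zero to fzero; suc to fsuc; _<_ to _<ᶠ_)
open import Data.Fin.Properties using (toℕ-fromℕ<)
open import Data.Vec using ([]; _∷_; lookup; updateAt; replicate)
open import Data.Vec.Properties
  using (≡-dec; updateAt-updateAt; updateAt-id; updateAt-id-local; lookup∘updateAt; lookup∘updateAt′)
open import Data.List using (List; []; _∷_; length; map; drop)
open import Data.List.Properties using (length-map)
open import Data.List.Membership.Propositional using (_∈_; find)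
open import Data.List.Membership.Propositional.Properties
  using (∈-map⁺; ∈-map⁻; ∈-filter⁺; ∈-filter⁻)
open import Data.List.Relation.Unary.All as All using (All; []; _∷_)
import Data.List.Relation.Unary.All.Properties as All
open import Data.List.Relation.Unary.Any using (Any; here; there)
open import Data.List.Relation.Unary.AllPairs as AllPairs using (AllPairs; []; _∷_)
import Data.List.Relation.Unary.AllPairs.Properties as AllPairs
open import Data.List.Relation.Unary.Linked as Linked using (Linked)
open import Data.List.Relation.Unary.Linked.Properties using (Linked⇒AllPairs; AllPairs⇒Linked)
open import Data.Product using (_×_; _,_; proj₁; proj₂; ∃-syntax)
open import Data.Sum using (_⊎_; inj₁; inj₂; [_,_])
open import Data.Empty using (⊥-elim)
open import Function using (_∘_)
open import Relation.Nullary using (¬_; yes; no)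
open import Relation.Binary.PropositionalEquality hiding (J; [_])
open import Relation.Binary.Definitions using (tri<; tri≈; tri>)

private
  variable
    n : ℕ

-- Terms

-- coord τ j is the exponent of x_{j+1} in τ; it is 0 for j ≥ n.
coord : Term n → ℕ → ℕ
coord []       j       = 0
coord (x ∷ xs) zero    = x
coord (x ∷ xs) (suc j) = coord xs j

coord-ext : (τ σ : Term n) → (∀ j → coord τ j ≡ coord σ j) → τ ≡ σ
coord-ext []       []       eq = refl
coord-ext (x ∷ xs) (y ∷ ys) eq = cong₂ _∷_ (eq 0) (coord-ext xs ys (eq ∘ suc))

coord-lookup : ∀ (τ : Term n) (J : Fin n) → coord τ (toℕ J) ≡ lookup τ J
coord-lookup (x ∷ xs) fzero    = refl
coord-lookup (x ∷ xs) (fsuc J) = coord-lookup xs J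

coord-beyond : ∀ (τ : Term n) j → n ≤ j → coord τ j ≡ 0
coord-beyond []       j       _         = refl
coord-beyond (x ∷ xs) (suc j) (s≤s n≤j) = coord-beyond xs j n≤j

coord-updateAt-≡ : ∀ (τ : Term n) (J : Fin n) f j → toℕ J ≡ j →
                   coord (updateAt τ J f) j ≡ f (coord τ j)
coord-updateAt-≡ (x ∷ xs) fzero    f zero    refl = refl
coord-updateAt-≡ (x ∷ xs) (fsuc J) f (suc j) refl = coord-updateAt-≡ xs J f j refl

coord-updateAt-≢ : ∀ (τ : Term n) (J : Fin n) f j → j ≢ toℕ J →
                   coord (updateAt τ J f) j ≡ coord τ j
coord-updateAt-≢ (x ∷ xs) fzero    f zero    j≢J = ⊥-elim (j≢J refl)
coord-updateAt-≢ (x ∷ xs) fzero    f (suc j) j≢J = refl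
coord-updateAt-≢ (x ∷ xs) (fsuc J) f zero    j≢J = refl
coord-updateAt-≢ (x ∷ xs) (fsuc J) f (suc j) j≢J = coord-updateAt-≢ xs J f j (j≢J ∘ cong suc)

coord-zeroFirst-< : ∀ m (τ : Term n) j → j < m → coord (zeroFirst m τ) j ≡ 0
coord-zeroFirst-< (suc m) []       j       _         = refl
coord-zeroFirst-< (suc m) (x ∷ xs) zero    _         = refl
coord-zeroFirst-< (suc m) (x ∷ xs) (suc j) (s≤s j<m) = coord-zeroFirst-< m xs j j<m

coord-zeroFirst-≥ : ∀ m (τ : Term n) j → m ≤ j → coord (zeroFirst m τ) j ≡ coord τ j
coord-zeroFirst-≥ zero    τ        j       _         = refl
coord-zeroFirst-≥ (suc m) []       j       _         = refl
coord-zeroFirst-≥ (suc m) (x ∷ xs) (suc j) (s≤s m≤j) = coord-zeroFirst-≥ m xs j m≤j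

record AgreeFrom (m : ℕ) (τ σ : Term n) : Set where
  constructor agreeFrom
  field agree : ∀ j → m ≤ j → coord τ j ≡ coord σ j
open AgreeFrom

AgreeFrom-sym : ∀ {m} {τ σ : Term n} → AgreeFrom m τ σ → AgreeFrom m σ τ
AgreeFrom-sym τ~σ = agreeFrom λ j m≤j → sym (agree τ~σ j m≤j)

AgreeFrom-trans : ∀ {m} {τ σ ρ : Term n} → AgreeFrom m τ σ → AgreeFrom m σ ρ → AgreeFrom m τ ρ
AgreeFrom-trans τ~σ σ~ρ = agreeFrom λ j m≤j → trans (agree τ~σ j m≤j) (agree σ~ρ j m≤j)

AgreeFrom-weaken : ∀ {m m′} {τ σ : Term n} → m ≤ m′ → AgreeFrom m τ σ → AgreeFrom m′ τ σ
AgreeFrom-weaken m≤m′ τ~σ = agreeFrom λ j m′≤j → agree τ~σ j (≤-trans m≤m′ m′≤j)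

AgreeFrom-pred : ∀ {p} {τ σ : Term n} → AgreeFrom (suc p) τ σ → coord τ p ≡ coord σ p →
                 AgreeFrom p τ σ
AgreeFrom-pred {p = p} {τ} {σ} τ~σ eq = agreeFrom at
  where
  at : ∀ j → p ≤ j → coord τ j ≡ coord σ j
  at j p≤j with m≤n⇒m<n∨m≡n p≤j
  ... | inj₁ p<j  = agree τ~σ j p<j
  ... | inj₂ refl = eq

AgreeFrom-beyond : (τ σ : Term n) → AgreeFrom n τ σ
AgreeFrom-beyond τ σ = agreeFrom λ j n≤j → trans (coord-beyond τ j n≤j) (sym (coord-beyond σ j n≤j))

zeroFirst-≡⇒AgreeFrom : ∀ m (τ σ : Term n) → zeroFirst m τ ≡ zeroFirst m σ → AgreeFrom m τ σ
zeroFirst-≡⇒AgreeFrom m τ σ eq = agreeFrom λ j m≤j → begin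
  coord τ j               ≡⟨ coord-zeroFirst-≥ m τ j m≤j ⟨
  coord (zeroFirst m τ) j ≡⟨ cong (λ v → coord v j) eq ⟩
  coord (zeroFirst m σ) j ≡⟨ coord-zeroFirst-≥ m σ j m≤j ⟩
  coord σ j               ∎
  where open ≡-Reasoning

AgreeFrom⇒zeroFirst-≡ : ∀ m (τ σ : Term n) → AgreeFrom m τ σ → zeroFirst m τ ≡ zeroFirst m σ
AgreeFrom⇒zeroFirst-≡ m τ σ τ~σ = coord-ext _ _ coords
  where
  coords : ∀ j → coord (zeroFirst m τ) j ≡ coord (zeroFirst m σ) j
  coords j with m ≤? j
  ... | yes m≤j = trans (coord-zeroFirst-≥ m τ j m≤j)
                        (trans (agree τ~σ j m≤j) (sym (coord-zeroFirst-≥ m σ j m≤j)))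
  ... | no  m≰j = trans (coord-zeroFirst-< m τ j (≰⇒> m≰j))
                        (sym (coord-zeroFirst-< m σ j (≰⇒> m≰j)))

Lex : Term n → Term n → Set
Lex τ σ = ∃[ j ] coord τ j < coord σ j × AgreeFrom (suc j) τ σ

<lex⇒Lex : (τ σ : Term n) → τ <lex σ → Lex τ σ
<lex⇒Lex []       []       ()
<lex⇒Lex (a ∷ as) (b ∷ bs) (inj₁ as<bs) with <lex⇒Lex as bs as<bs
... | j , lt , above = suc j , lt , agreeFrom λ { (suc j′) (s≤s j<j′) → agree above j′ j<j′ }
<lex⇒Lex (a ∷ as) (b ∷ as) (inj₂ (refl , a<b)) = 0 , a<b , agreeFrom λ { (suc j′) _ → refl }

Lex-trans : {τ σ ρ : Term n} → Lex τ σ → Lex σ ρ → Lex τ ρ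
Lex-trans {τ = τ} {σ} {ρ} (j , lt , above) (j′ , lt′ , above′) with <-cmp j j′
... | tri< j<j′ _ _ = j′ , subst (_< coord ρ j′) (sym (agree above j′ j<j′)) lt′
                         , AgreeFrom-trans (AgreeFrom-weaken (<⇒≤ (s≤s j<j′)) above) above′
... | tri≈ _ refl _ = j , <-trans lt lt′ , AgreeFrom-trans above above′
... | tri> _ _ j>j′ = j , subst (coord τ j <_) (agree above′ j j>j′) lt
                         , AgreeFrom-trans above (AgreeFrom-weaken (<⇒≤ (s≤s j>j′)) above′)

Lex-irrefl : {τ : Term n} → ¬ Lex τ τ
Lex-irrefl (j , lt , _) = <-irrefl refl lt

Lex-firstDifference : ∀ p {τ σ : Term n} → Lex τ σ → AgreeFrom (suc p) τ σ →
                      coord τ p ≢ coord σ p → coord τ p < coord σ p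
Lex-firstDifference p (j , lt , above) τ~σ ne with <-cmp j p
... | tri< j<p _ _ = ⊥-elim (ne (agree above p j<p))
... | tri≈ _ refl _ = lt
... | tri> _ _ j>p = ⊥-elim (<-irrefl (agree τ~σ j j>p) lt)

zeroFirst-Lex : ∀ m {τ σ : Term n} → Lex τ σ →
                zeroFirst m τ ≡ zeroFirst m σ ⊎ Lex (zeroFirst m τ) (zeroFirst m σ)
zeroFirst-Lex m {τ} {σ} (j , lt , above) with m ≤? j
... | yes m≤j = inj₂ (j , subst₂ _<_ (sym (coord-zeroFirst-≥ m τ j m≤j))
                                      (sym (coord-zeroFirst-≥ m σ j m≤j)) lt
                        , agreeFrom λ j′ j<j′ → let m≤j′ = ≤-trans m≤j (<⇒≤ j<j′) in
                            trans (coord-zeroFirst-≥ m τ j′ m≤j′)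
                                  (trans (agree above j′ j<j′) (sym (coord-zeroFirst-≥ m σ j′ m≤j′))))
... | no  m≰j = inj₁ (AgreeFrom⇒zeroFirst-≡ m τ σ (AgreeFrom-weaken (≰⇒> m≰j) above))

_∣ᵗ_ : Term n → Term n → Set
σ ∣ᵗ τ = ∀ j → coord σ j ≤ coord τ j

zeroFirst-∣ᵗ : ∀ m (τ : Term n) → zeroFirst m τ ∣ᵗ τ
zeroFirst-∣ᵗ m τ j with m ≤? j
... | yes m≤j = ≤-reflexive (coord-zeroFirst-≥ m τ j m≤j)
... | no  m≰j = subst (_≤ coord τ j) (sym (coord-zeroFirst-< m τ j (≰⇒> m≰j))) z≤n

monomialIdeal-∣ᵗ : {I : Term n → Set} → IsMonomialIdeal I →
                   ∀ {σ τ} → σ ∣ᵗ τ → I σ → I τ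
monomialIdeal-∣ᵗ {I = I} ideal {[]}     {[]}     _   σ∈I = σ∈I
monomialIdeal-∣ᵗ {I = I} ideal {a ∷ as} {b ∷ bs} σ∣τ σ∈I =
  monomialIdeal-∣ᵗ {I = λ ys → I (b ∷ ys)} (λ τ J → ideal (b ∷ τ) (fsuc J)) (σ∣τ ∘ suc)
    (subst (λ c → I (c ∷ as)) (m∸n+n≡m (σ∣τ 0)) (raise (b ∸ a) σ∈I))
  where
  raise : ∀ k → I (a ∷ as) → I (k + a ∷ as)
  raise zero    a∈I = a∈I
  raise (suc k) a∈I = ideal _ fzero (raise k a∈I)

stable-shift-∉ : {I : Term n → Set} → IsStable I → ∀ (U J : Fin n) {σ} → U <ᶠ J →
                 (∀ k → k <ᶠ U → lookup σ k ≡ 0) → 0 < lookup σ J →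
                 ¬ I σ → ¬ I (mulVar U (divVar J σ))
stable-shift-∉ {n} {I} stable U J {σ} U<J below σ[J]>0 σ∉I ρ∈I =
  σ∉I (subst I shift-back (stable ρ U J ρ∈I minVar U<J))
  where
  ρ : Term n
  ρ = mulVar U (divVar J σ)
  minVar : IsMinVar ρ U
  minVar = subst (0 <_) (sym (lookup∘updateAt U (divVar J σ))) (s≤s z≤n)
         , λ k k<U → trans (lookup∘updateAt′ k U (λ { refl → <-irrefl refl k<U }) (divVar J σ))
                    (trans (lookup∘updateAt′ k J (λ { refl → <-irrefl refl (<-trans k<U U<J) }) σ)
                           (below k k<U))
  shift-back : mulVar J (divVar U ρ) ≡ σ
  shift-back = begin
    updateAt (updateAt (updateAt (updateAt σ J pred) U suc) U pred) J suc
      ≡⟨ cong (λ v → updateAt v J suc) (trans (updateAt-updateAt U _) (updateAt-id U _)) ⟩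
    updateAt (updateAt σ J pred) J suc
      ≡⟨ updateAt-updateAt J σ ⟩
    updateAt σ J (suc ∘ pred)
      ≡⟨ updateAt-id-local J σ (suc-pred (lookup σ J) {{>-nonZero σ[J]>0}}) ⟩
    σ ∎
    where open ≡-Reasoning

-- ρ′ = x_{u+1}^{coord σ u + 1} P_{i+1}(τ) divides ρ = x_{u+1} P_{u+1}(σ) / x_{i+1},
-- and ρ ∉ I by stability.
stable-raise-∉ : {I : Term n → Set} → IsMonomialIdeal I → IsStable I →
                 ∀ {u i} → u < i → i < n → {τ σ : Term n} →
                 AgreeFrom (suc i) τ σ → coord τ i < coord σ i → ¬ I σ →
                 ∃[ ρ′ ] ¬ I ρ′ × AgreeFrom i ρ′ τ × coord ρ′ u ≡ suc (coord σ u)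
stable-raise-∉ {n} {I} ideal stable {u} {i} u<i i<n {τ} {σ} τ~σ τᵢ<σᵢ σ∉I =
  ρ′ , (λ ρ′∈I → ρ∉I (monomialIdeal-∣ᵗ ideal ρ′∣ρ ρ′∈I))
  , agreeFrom (λ j i≤j → trans (ρ′-off (λ { refl → <⇒≱ u<i i≤j })) (coord-zeroFirst-≥ i τ j i≤j))
  , coord-updateAt-≡ (zeroFirst i τ) U _ u toU
  where
  open ≤-Reasoning
  U J : Fin n
  U = fromℕ< (<-trans u<i i<n)
  J = fromℕ< i<n
  toU : toℕ U ≡ u
  toU = toℕ-fromℕ< (<-trans u<i i<n)
  toJ : toℕ J ≡ i
  toJ = toℕ-fromℕ< i<n
  σ′ ρ ρ′ : Term n
  σ′ = zeroFirst u σ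
  ρ = mulVar U (divVar J σ′)
  ρ′ = updateAt (zeroFirst i τ) U (λ _ → suc (coord σ u))

  ρ∉I : ¬ I ρ
  ρ∉I = stable-shift-∉ stable U J (subst₂ _<_ (sym toU) (sym toJ) u<i) below positive
          (λ σ′∈I → σ∉I (monomialIdeal-∣ᵗ ideal (zeroFirst-∣ᵗ u σ) σ′∈I))
    where
    below : ∀ k → k <ᶠ U → lookup σ′ k ≡ 0
    below k k<U = trans (sym (coord-lookup σ′ k))
                        (coord-zeroFirst-< u σ (toℕ k) (subst (toℕ k <_) toU k<U))
    positive : 0 < lookup σ′ J
    positive = subst (0 <_)
      (trans (sym (coord-zeroFirst-≥ u σ i (<⇒≤ u<i)))
             (trans (cong (coord σ′) (sym toJ)) (coord-lookup σ′ J)))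
      (≤-<-trans z≤n τᵢ<σᵢ)

  ρ′-off : ∀ {j} → j ≢ u → coord ρ′ j ≡ coord (zeroFirst i τ) j
  ρ′-off j≢u = coord-updateAt-≢ (zeroFirst i τ) U _ _ (λ e → j≢u (trans e toU))
  ρ-off : ∀ {j} → j ≢ u → coord ρ j ≡ coord (divVar J σ′) j
  ρ-off j≢u = coord-updateAt-≢ (divVar J σ′) U suc _ (λ e → j≢u (trans e toU))

  ρ′∣ρ : ρ′ ∣ᵗ ρ
  ρ′∣ρ j with j ≟ u | <-cmp j i
  ... | yes refl | _ = begin
    coord ρ′ u                    ≡⟨ coord-updateAt-≡ (zeroFirst i τ) U _ u toU ⟩
    suc (coord σ u)               ≡⟨ cong suc (coord-zeroFirst-≥ u σ u ≤-refl) ⟨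
    suc (coord σ′ u)              ≡⟨ cong suc (coord-updateAt-≢ σ′ J pred u u≢J) ⟨
    suc (coord (divVar J σ′) u)   ≡⟨ coord-updateAt-≡ (divVar J σ′) U suc u toU ⟨
    coord ρ u                     ∎
    where
    u≢J : u ≢ toℕ J
    u≢J e = <-irrefl (trans e toJ) u<i
  ... | no j≢u | tri< j<i _ _ =
    subst (_≤ coord ρ j) (sym (trans (ρ′-off j≢u) (coord-zeroFirst-< i τ j j<i))) z≤n
  ... | no j≢u | tri≈ _ refl _ = begin
    coord ρ′ i                   ≡⟨ trans (ρ′-off j≢u) (coord-zeroFirst-≥ i τ i ≤-refl) ⟩
    coord τ i                    ≤⟨ <⇒≤pred τᵢ<σᵢ ⟩
    pred (coord σ i)             ≡⟨ cong pred (coord-zeroFirst-≥ u σ i (<⇒≤ u<i)) ⟨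
    pred (coord σ′ i)            ≡⟨ coord-updateAt-≡ σ′ J pred i toJ ⟨
    coord (divVar J σ′) i        ≡⟨ ρ-off j≢u ⟨
    coord ρ i                    ∎
  ... | no j≢u | tri> _ j≢i i<j = begin
    coord ρ′ j                   ≡⟨ trans (ρ′-off j≢u) (coord-zeroFirst-≥ i τ j (<⇒≤ i<j)) ⟩
    coord τ j                    ≡⟨ agree τ~σ j i<j ⟩
    coord σ j                    ≡⟨ coord-zeroFirst-≥ u σ j (<⇒≤ (<-trans u<i i<j)) ⟨
    coord σ′ j                   ≡⟨ coord-updateAt-≢ σ′ J pred j (λ e → j≢i (trans e toJ)) ⟨
    coord (divVar J σ′) j        ≡⟨ ρ-off j≢u ⟨
    coord ρ j                    ∎

-- Reading past the end of the list yields the zero term.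
_‼_ : List (Term n) → ℕ → Term n
_‼_ {n} []       q       = replicate n 0
(x ∷ xs)         ‼ zero  = x
(x ∷ xs)         ‼ suc q = xs ‼ q

‼-map : ∀ (f : Term n → Term n) xs q → q < length xs → map f xs ‼ q ≡ f (xs ‼ q)
‼-map f (x ∷ xs) zero    _         = refl
‼-map f (x ∷ xs) (suc q) (s≤s q<l) = ‼-map f xs q q<l

‼-∈ : ∀ (xs : List (Term n)) q → q < length xs → xs ‼ q ∈ xs
‼-∈ (x ∷ xs) zero    _         = here refl
‼-∈ (x ∷ xs) (suc q) (s≤s q<l) = there (‼-∈ xs q q<l)

∈⇒‼ : ∀ {τ : Term n} xs → τ ∈ xs → ∃[ q ] q < length xs × xs ‼ q ≡ τ
∈⇒‼ (x ∷ xs) (here refl) = 0 , s≤s z≤n , refl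
∈⇒‼ (x ∷ xs) (there τ∈xs) with ∈⇒‼ xs τ∈xs
... | q , q<l , eq = suc q , s≤s q<l , eq

AllPairs-‼ : ∀ {R : Term n → Term n → Set} {xs} → AllPairs R xs →
             ∀ {q q′} → q < q′ → q′ < length xs → R (xs ‼ q) (xs ‼ q′)
AllPairs-‼ {xs = x ∷ xs} (Rx ∷ _)  {zero}  {suc q′} _         (s≤s q′<l) = All-‼ Rx q′<l
  where
  All-‼ : ∀ {P : Term n → Set} {ys q} → All P ys → q < length ys → P (ys ‼ q)
  All-‼ {ys = y ∷ ys} {zero}  (Py ∷ _)   _         = Py
  All-‼ {ys = y ∷ ys} {suc q} (_  ∷ Pys) (s≤s q<l) = All-‼ Pys q<l
AllPairs-‼ {xs = x ∷ xs} (_ ∷ Rxs) {suc q} {suc q′} (s≤s q<q′) (s≤s q′<l) = AllPairs-‼ Rxs q<q′ q′<l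

AllPairs-restrict : ∀ {A : Set} {P : A → Set} {R S : A → A → Set} {xs} → All P xs → AllPairs R xs →
                    (∀ {x y} → P x → P y → R x y → S x y) → AllPairs S xs
AllPairs-restrict []         []         f = []
AllPairs-restrict (Px ∷ Pxs) (Rx ∷ Rxs) f =
  All.zipWith (λ (Py , Rxy) → f Px Py Rxy) (Pxs , Rx) ∷ AllPairs-restrict Pxs Rxs f

∈-tail : ∀ {x y : ℕ} {ys} → x ∈ y ∷ ys → y < x → x ∈ ys
∈-tail (here refl) y<x = ⊥-elim (<-irrefl refl y<x)
∈-tail (there x∈ys) _  = x∈ys

increasing-⊆⇒length≤ : ∀ {xs ys : List ℕ} → AllPairs _<_ xs → AllPairs _<_ ys →
                       (∀ {x} → x ∈ xs → x ∈ ys) → length xs ≤ length ys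
increasing-⊆⇒length≤ {[]}     _ _ _ = z≤n
increasing-⊆⇒length≤ {x ∷ xs} {[]} _ _ xs⊆ys with xs⊆ys (here refl)
... | ()
increasing-⊆⇒length≤ {x ∷ xs} {y ∷ ys} (x< ∷ xs↑) (y< ∷ ys↑) xs⊆ys with xs⊆ys (here refl)
... | here refl =
  s≤s (increasing-⊆⇒length≤ xs↑ ys↑ λ z∈xs → ∈-tail (xs⊆ys (there z∈xs)) (All.lookup x< z∈xs))
... | there x∈ys = m≤n⇒m≤1+n (increasing-⊆⇒length≤ (x< ∷ xs↑) ys↑ x∷xs⊆ys)
  where
  x∷xs⊆ys : ∀ {z} → z ∈ x ∷ xs → z ∈ ys
  x∷xs⊆ys (here refl) = x∈ys
  x∷xs⊆ys (there z∈xs) =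
    ∈-tail (xs⊆ys (there z∈xs)) (<-trans (All.lookup y< x∈ys) (All.lookup x< z∈xs))

drop-∷ : ∀ c (R : List (Term n)) {x xs} → drop c R ≡ x ∷ xs →
         R ‼ c ≡ x × drop (suc c) R ≡ xs × c < length R
drop-∷ zero    (r ∷ R) refl = refl , refl , s≤s z≤n
drop-∷ (suc c) (r ∷ R) eq with drop-∷ c R eq
... | at , rest , c<l = at , rest , s≤s c<l

drop-[] : ∀ c (R : List (Term n)) → drop c R ≡ [] → length R ≤ c
drop-[] zero    []      _  = z≤n
drop-[] (suc c) []      _  = z≤n
drop-[] (suc c) (r ∷ R) eq = s≤s (drop-[] c R eq)

-- Bars

_≺_ : Bar → Bar → Set
(a , b) ≺ (a′ , b′) = b < a′

_∈ᵇ_ : ℕ → Bar → Set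
q ∈ᵇ (a , b) = a ≤ q × q ≤ b

module MaximalRuns (R : List (Term n)) where

  IsMaximalRun : Bar → Set
  IsMaximalRun (a , b) = a ≤ b × b < length R × (∀ q → q ∈ᵇ (a , b) → R ‼ q ≡ R ‼ a)
                       × (0 < a → R ‼ pred a ≢ R ‼ a) × (suc b < length R → R ‼ suc b ≢ R ‼ a)

  record AreRunsFrom (s : ℕ) (bs : List Bar) : Set where
    field
      maximal    : All IsMaximalRun bs
      startsFrom : All (λ B → s ≤ proj₁ B) bs
      ordered    : AllPairs _≺_ bs
      covering   : ∀ q → s ≤ q → q < length R → Any (q ∈ᵇ_) bs
  open AreRunsFrom

  -- The state of runsFrom s c p xs: the current run started at s and reached c with
  -- value p, and xs is what is left of R after position c.
  OpenRun : ℕ → ℕ → Term n → List (Term n) → Set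
  OpenRun s c p xs = s ≤ c × c < length R × R ‼ c ≡ p × drop (suc c) R ≡ xs
                   × (∀ q → q ∈ᵇ (s , c) → R ‼ q ≡ p) × (0 < s → R ‼ pred s ≢ p)

  closedRun : ∀ {s c p xs} → OpenRun s c p xs → (suc c < length R → R ‼ suc c ≢ p) →
              IsMaximalRun (s , c)
  closedRun {s} {c} {p} (s≤c , c<l , _ , _ , constant , leftMaximal) rightMaximal =
    s≤c , c<l , (λ q q∈ → trans (constant q q∈) (sym Rs≡p))
    , (λ 0<s → subst (R ‼ pred s ≢_) (sym Rs≡p) (leftMaximal 0<s))
    , (λ sc<l → subst (R ‼ suc c ≢_) (sym Rs≡p) (rightMaximal sc<l))
    where
    Rs≡p : R ‼ s ≡ p
    Rs≡p = constant s (≤-refl , s≤c)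

  runsFrom-spec : ∀ s c p xs → OpenRun s c p xs → AreRunsFrom s (runsFrom s c p xs)
  runsFrom-spec s c p [] run@(s≤c , _ , _ , rest , _) = record
    { maximal     = closedRun run (λ sc<l → ⊥-elim (<⇒≱ sc<l (drop-[] (suc c) R rest))) ∷ []
    ; startsFrom  = ≤-refl ∷ []
    ; ordered     = [] ∷ []
    ; covering    = λ q s≤q q<l → here (s≤q , m<1+n⇒m≤n (<-≤-trans q<l (drop-[] (suc c) R rest)))
    }
  runsFrom-spec s c p (x ∷ xs) run@(s≤c , c<l , Rc , rest , constant , leftMaximal)
    with ≡-dec _≟_ p x | drop-∷ (suc c) R rest
  ... | yes refl | Rsc , rest′ , sc<l =
    runsFrom-spec s (suc c) p xs (m≤n⇒m≤1+n s≤c , sc<l , Rsc , rest′ , constant′ , leftMaximal)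
    where
    constant′ : ∀ q → q ∈ᵇ (s , suc c) → R ‼ q ≡ p
    constant′ q (s≤q , q≤sc) with m≤n⇒m<n∨m≡n q≤sc
    ... | inj₁ q<sc = constant q (s≤q , m<1+n⇒m≤n q<sc)
    ... | inj₂ refl = Rsc
  ... | no p≢x | Rsc , rest′ , sc<l = record
    { maximal     = closedRun run (λ _ eq → p≢x (trans (sym eq) Rsc)) ∷ maximal next
    ; startsFrom  = ≤-refl ∷ All.map (≤-trans (m≤n⇒m≤1+n s≤c)) (startsFrom next)
    ; ordered     = startsFrom next ∷ ordered next
    ; covering    = covering′
    }
    where
    next : AreRunsFrom (suc c) (runsFrom (suc c) (suc c) x xs)
    next = runsFrom-spec (suc c) (suc c) x xs
      (≤-refl , sc<l , Rsc , rest′ , (λ q (l , u) → subst (λ v → R ‼ v ≡ x) (≤-antisym l u) Rsc)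
      , λ _ eq → p≢x (trans (sym Rc) eq))
    covering′ : ∀ q → s ≤ q → q < length R → Any (q ∈ᵇ_) ((s , c) ∷ runsFrom (suc c) (suc c) x xs)
    covering′ q s≤q q<l with q ≤? c
    ... | yes q≤c = here (s≤q , q≤c)
    ... | no  q≰c = there (covering next q (≰⇒> q≰c) q<l)

open MaximalRuns using (AreRunsFrom; IsMaximalRun)
open MaximalRuns.AreRunsFrom

runs-spec : (R : List (Term n)) → AreRunsFrom R 0 (runs R)
runs-spec []       = record { maximal = [] ; startsFrom  = [] ; ordered = [] ; covering = λ _ _ () }
runs-spec (x ∷ xs) = MaximalRuns.runsFrom-spec (x ∷ xs) 0 0 x xs
  (z≤n , s≤s z≤n , refl , refl , (λ { zero _ → refl }) , λ ())

module SortedBars {n : ℕ} (L : List (Term n)) (sorted : Linked _<lex_ L) where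

  Lex-‼ : ∀ {q q′} → q < q′ → q′ < length L → Lex (L ‼ q) (L ‼ q′)
  Lex-‼ = AllPairs-‼ (Linked⇒AllPairs Lex-trans (Linked.map (<lex⇒Lex _ _) sorted))

  P-nondecreasing : ∀ k {q q′} → q ≤ q′ → q′ < length L →
                    P k (L ‼ q) ≡ P k (L ‼ q′) ⊎ Lex (P k (L ‼ q)) (P k (L ‼ q′))
  P-nondecreasing k q≤q′ q′<l with m≤n⇒m<n∨m≡n q≤q′
  ... | inj₁ q<q′ = zeroFirst-Lex (k ∸ 1) (Lex-‼ q<q′ q′<l)
  ... | inj₂ refl = inj₁ refl

  P-convex : ∀ k {q₁ q₂ q₃} → q₁ ≤ q₂ → q₂ ≤ q₃ → q₃ < length L →
             P k (L ‼ q₁) ≡ P k (L ‼ q₃) → P k (L ‼ q₂) ≡ P k (L ‼ q₁)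
  P-convex k q₁≤q₂ q₂≤q₃ q₃<l eq with P-nondecreasing k q₁≤q₂ (≤-<-trans q₂≤q₃ q₃<l)
  ... | inj₁ eq₁₂ = sym eq₁₂
  ... | inj₂ lt₁₂ = ⊥-elim (Lex-irrefl (subst (Lex _) (sym eq)
                      ([ (λ eq₂₃ → subst (Lex _) eq₂₃ lt₁₂) , Lex-trans lt₁₂ ]
                         (P-nondecreasing k q₂≤q₃ q₃<l))))

  -- A k-bar of the Bar Code of L is exactly a fibre of P_k on the positions of L.
  record IsBar (k : ℕ) (B : Bar) : Set where
    field
      start≤end  : proj₁ B ≤ proj₂ B
      end<length : proj₂ B < length L
      constant   : ∀ q → q ∈ᵇ B → P k (L ‼ q) ≡ P k (L ‼ proj₁ B)
      fibre      : ∀ q → q < length L → P k (L ‼ q) ≡ P k (L ‼ proj₁ B) → q ∈ᵇ B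

    start<length : proj₁ B < length L
    start<length = ≤-<-trans start≤end end<length
  open IsBar public

  maximalRun⇒IsBar : ∀ k B → IsMaximalRun (row L k) B → IsBar k B
  maximalRun⇒IsBar k (a , b) (a≤b , b<l′ , run , leftMaximal , rightMaximal) = record
    { start≤end = a≤b ; end<length = b<l ; constant = constant′ ; fibre = fibre′ }
    where
    length-row : length (row L k) ≡ length L
    length-row = length-map (P k) L
    b<l : b < length L
    b<l = subst (b <_) length-row b<l′
    row-‼ : ∀ {q} → q < length L → row L k ‼ q ≡ P k (L ‼ q)
    row-‼ q<l = ‼-map (P k) L _ q<l
    a<l : a < length L
    a<l = ≤-<-trans a≤b b<l
    constant′ : ∀ q → q ∈ᵇ (a , b) → P k (L ‼ q) ≡ P k (L ‼ a)
    constant′ q q∈@(_ , q≤b) =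
      trans (sym (row-‼ (≤-<-trans q≤b b<l))) (trans (run q q∈) (row-‼ a<l))
    fibre′ : ∀ q → q < length L → P k (L ‼ q) ≡ P k (L ‼ a) → q ∈ᵇ (a , b)
    fibre′ q q<l eq with a ≤? q | q ≤? b
    ... | yes a≤q | yes q≤b = a≤q , q≤b
    ... | no  a≰q | _       = ⊥-elim (leftMaximal (≤-<-trans z≤n q<a)
          (trans (row-‼ (≤-<-trans pred[n]≤n a<l))
                 (trans (P-convex k (<⇒≤pred q<a) pred[n]≤n a<l eq)
                        (trans eq (sym (row-‼ a<l))))))
      where
      q<a : q < a
      q<a = ≰⇒> a≰q
    ... | yes a≤q | no  q≰b = ⊥-elim (rightMaximal (subst (suc b <_) (sym length-row) sb<l)
          (trans (row-‼ sb<l)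
                 (trans (P-convex k (m≤n⇒m≤1+n a≤b) b<q q<l (sym eq)) (sym (row-‼ a<l)))))
      where
      b<q : b < q
      b<q = ≰⇒> q≰b
      sb<l : suc b < length L
      sb<l = <-≤-trans (s≤s b<q) q<l

  bars-IsBar : ∀ k → All (IsBar k) (bars L k)
  bars-IsBar k = All.map (maximalRun⇒IsBar k _) (maximal (runs-spec (row L k)))

  bars-cover : ∀ k q → q < length L → ∃[ D ] D ∈ bars L k × q ∈ᵇ D
  bars-cover k q q<l =
    find (covering (runs-spec (row L k)) q z≤n (subst (q <_) (sym (length-map (P k) L)) q<l))

  bars-allPairs : ∀ {R : Bar → Bar → Set} k →
                  (∀ {C C′} → IsBar k C → IsBar k C′ → C ≺ C′ → R C C′) → AllPairs R (bars L k)
  bars-allPairs k = AllPairs-restrict (bars-IsBar k) (ordered (runs-spec (row L k)))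

  barsOver-allPairs : ∀ {R : Bar → Bar → Set} k B →
                      (∀ {C C′} → IsBar k C → IsBar k C′ → C ⊑ B → C′ ⊑ B → C ≺ C′ → R C C′) →
                      AllPairs R (barsOver L k B)
  barsOver-allPairs k B f = AllPairs-restrict
    (All.zip (All.filter⁺ (_⊑? B) (bars-IsBar k) , All.all-filter (_⊑? B) (bars L k)))
    (AllPairs.filter⁺ (_⊑? B) (ordered (runs-spec (row L k))))
    (λ (bC , C⊑B) (bC′ , C′⊑B) → f bC bC′ C⊑B C′⊑B)

  IsBar-agree : ∀ {k B q} → IsBar k B → q ∈ᵇ B → AgreeFrom (k ∸ 1) (L ‼ q) (L ‼ proj₁ B)
  IsBar-agree {k} bar q∈B = zeroFirst-≡⇒AgreeFrom (k ∸ 1) _ _ (constant bar _ q∈B)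

  agree-IsBar : ∀ {k B q} → IsBar k B → q < length L → AgreeFrom (k ∸ 1) (L ‼ q) (L ‼ proj₁ B) →
                q ∈ᵇ B
  agree-IsBar {k} bar q<l q~B = fibre bar _ q<l (AgreeFrom⇒zeroFirst-≡ (k ∸ 1) _ _ q~B)

  ≺-coord< : ∀ {p C C′} → IsBar (suc p) C → IsBar (suc p) C′ → C ≺ C′ →
             AgreeFrom (suc p) (L ‼ proj₁ C) (L ‼ proj₁ C′) →
             coord (L ‼ proj₁ C) p < coord (L ‼ proj₁ C′) p
  ≺-coord< {p} {a , b} {a′ , b′} barC barC′ b<a′ C~C′ =
    Lex-firstDifference p (Lex-‼ (≤-<-trans (start≤end barC) b<a′) (start<length barC′)) C~C′ differ
    where
    differ : coord (L ‼ a) p ≢ coord (L ‼ a′) p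
    differ eq = <⇒≱ b<a′ (proj₂ (agree-IsBar barC (start<length barC′)
                                   (AgreeFrom-sym (AgreeFrom-pred C~C′ eq))))

  ⊑-agree : ∀ {k k′ B C} → IsBar k B → IsBar k′ C → C ⊑ B →
            AgreeFrom (k ∸ 1) (L ‼ proj₁ C) (L ‼ proj₁ B)
  ⊑-agree barB barC (B≤C , C≤B) = IsBar-agree barB (B≤C , ≤-trans (start≤end barC) C≤B)

-- Bars over a stable ideal

module StableBars {n : ℕ} (I : Term n → Set) (ideal : IsMonomialIdeal I) (stable : IsStable I)
                  (L : List (Term n)) (sortedN : IsSortedN I L) where
  open SortedBars L (proj₁ sortedN)

  ‼-∉ : ∀ {q} → q < length L → ¬ I (L ‼ q)
  ‼-∉ q<l = proj₁ (proj₂ sortedN _) (‼-∈ L _ q<l)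

  ∉⇒‼ : ∀ {τ} → ¬ I τ → ∃[ q ] q < length L × L ‼ q ≡ τ
  ∉⇒‼ τ∉I = ∈⇒‼ L (proj₂ (proj₂ sortedN _) τ∉I)

  -- i = u + 1 indexes rows (P_i, i-bars) 1-based, u = i - 1 is the coordinate of x_i.
  module _ (u : ℕ) (i<n : suc u < n) where
    private
      i : ℕ
      i = suc u

    -- Within an (i+1)-bar, the i-bars are told apart by the exponent of x_i.
    exponents : Bar → List ℕ
    exponents C = map (λ D → coord (L ‼ proj₁ D) u) (barsOver L i C)

    exponents-increasing : ∀ {C} → IsBar (suc i) C → AllPairs _<_ (exponents C)
    exponents-increasing {C} barC = AllPairs.map⁺ (barsOver-allPairs i C increasing)
      where
      increasing : ∀ {D D′} → IsBar i D → IsBar i D′ → D ⊑ C → D′ ⊑ C → D ≺ D′ →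
                   coord (L ‼ proj₁ D) u < coord (L ‼ proj₁ D′) u
      increasing barD barD′ D⊑C D′⊑C D≺D′ = ≺-coord< barD barD′ D≺D′
        (AgreeFrom-trans (⊑-agree barC barD D⊑C) (AgreeFrom-sym (⊑-agree barC barD′ D′⊑C)))

    ∈-exponents⁻ : ∀ {C w} → IsBar (suc i) C → w ∈ exponents C →
                   ∃[ τ ] ¬ I τ × AgreeFrom i τ (L ‼ proj₁ C) × coord τ u ≡ w
    ∈-exponents⁻ {C} barC w∈ with ∈-map⁻ _ w∈
    ... | D , D∈ , refl with ∈-filter⁻ (_⊑? C) D∈
    ... | D∈bars , D⊑C =
      L ‼ proj₁ D , ‼-∉ (start<length barD) , ⊑-agree barC barD D⊑C , refl
      where
      barD : IsBar i D
      barD = All.lookup (bars-IsBar i) D∈bars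

    ∈-exponents⁺ : ∀ {C τ} → IsBar (suc i) C → ¬ I τ → AgreeFrom i τ (L ‼ proj₁ C) →
                    coord τ u ∈ exponents C
    ∈-exponents⁺ {C} barC τ∉I τ~C with ∉⇒‼ τ∉I
    ... | q , q<l , refl with bars-cover i q q<l
    ... | D@(s , e) , D∈bars , q∈D =
      subst (_∈ exponents C) (sym (agree (IsBar-agree barD q∈D) u ≤-refl))
        (∈-map⁺ _ (∈-filter⁺ (_⊑? C) D∈bars
          (proj₁ (inC s (≤-refl , start≤end barD)) , proj₂ (inC e (start≤end barD , ≤-refl)))))
      where
      barD : IsBar i D
      barD = All.lookup (bars-IsBar i) D∈bars
      inC : ∀ r → r ∈ᵇ D → r ∈ᵇ C
      inC r r∈D@(_ , r≤e) = agree-IsBar barC (≤-<-trans r≤e (end<length barD))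
        (AgreeFrom-trans (AgreeFrom-weaken (n≤1+n u)
          (AgreeFrom-trans (IsBar-agree barD r∈D) (AgreeFrom-sym (IsBar-agree barD q∈D)))) τ~C)

    zero-∈-exponents : ∀ {C} → IsBar (suc i) C → 0 ∈ exponents C
    zero-∈-exponents {a , b} barC =
      subst (_∈ exponents (a , b)) (coord-zeroFirst-< i (L ‼ a) u ≤-refl)
        (∈-exponents⁺ {τ = zeroFirst i (L ‼ a)} barC
          (λ τ∈I → ‼-∉ (start<length barC) (monomialIdeal-∣ᵗ ideal (zeroFirst-∣ᵗ i (L ‼ a)) τ∈I))
          (agreeFrom (coord-zeroFirst-≥ i (L ‼ a))))

    suc-∈-exponents : ∀ {C C′ w} → IsBar (suc i) C → IsBar (suc i) C′ →
                      AgreeFrom (suc i) (L ‼ proj₁ C) (L ‼ proj₁ C′) →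
                      coord (L ‼ proj₁ C) i < coord (L ‼ proj₁ C′) i →
                      w ∈ exponents C′ → suc w ∈ exponents C
    suc-∈-exponents {a , b} {a′ , b′} barC barC′ C~C′ Cᵢ<C′ᵢ w∈ with ∈-exponents⁻ barC′ w∈
    ... | σ , σ∉I , σ~C′ , refl with stable-raise-∉ ideal stable ≤-refl i<n C~σ Cᵢ<σᵢ σ∉I
      where
      C~σ : AgreeFrom (suc i) (L ‼ a) σ
      C~σ = AgreeFrom-trans C~C′ (AgreeFrom-sym (AgreeFrom-weaken (n≤1+n i) σ~C′))
      Cᵢ<σᵢ : coord (L ‼ a) i < coord σ i
      Cᵢ<σᵢ = subst (coord (L ‼ a) i <_) (sym (agree σ~C′ i ≤-refl)) Cᵢ<C′ᵢ
    ... | ρ , ρ∉I , ρ~C , ρᵤ = subst (_∈ exponents (a , b)) ρᵤ (∈-exponents⁺ barC ρ∉I ρ~C)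

    l-decreasing : ∀ {C C′} → IsBar (suc i) C → IsBar (suc i) C′ → C ≺ C′ →
                   AgreeFrom (suc i) (L ‼ proj₁ C) (L ‼ proj₁ C′) → l L i C′ < l L i C
    l-decreasing {C} {C′} barC barC′ C≺C′ C~C′ =
      subst₂ _≤_ (cong suc (trans (length-map suc (exponents C′)) (length-map _ (barsOver L i C′))))
                 (length-map _ (barsOver L i C))
        (increasing-⊆⇒length≤ shifted-increasing (exponents-increasing barC) shifted⊆)
      where
      shifted-increasing : AllPairs _<_ (0 ∷ map suc (exponents C′))
      shifted-increasing = All.map⁺ (All.universal (λ _ → s≤s z≤n) (exponents C′))
                         ∷ AllPairs.map⁺ (AllPairs.map s≤s (exponents-increasing barC′))
      shifted⊆ : ∀ {w} → w ∈ 0 ∷ map suc (exponents C′) → w ∈ exponents C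
      shifted⊆ (here refl) = zero-∈-exponents barC
      shifted⊆ (there w∈) with ∈-map⁻ suc w∈
      ... | w′ , w′∈ , refl =
        suc-∈-exponents barC barC′ C~C′ (≺-coord< barC barC′ C≺C′ C~C′) w′∈

mainTheorem4 : (n : ℕ) → 2 ≤ n →
    (I : Term n → Set) → IsMonomialIdeal I → IsStable I →
    (L : List (Term n)) → IsSortedN I L →
    Linked (λ B B′ → l L (n ∸ 1) B′ < l L (n ∸ 1) B) (bars L n)
    × (∀ (i : ℕ) → 1 ≤ i → i ≤ n ∸ 2 → ∀ (B : Bar) → B ∈ bars L (i + 2) →
        Linked (λ C C′ → l L i C′ < l L i C) (barsOver L (i + 1) B))
mainTheorem4 (suc (suc m)) (s≤s (s≤s z≤n)) I ideal stable L sortedN = partA , partB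
  where
  open SortedBars L (proj₁ sortedN)
  open StableBars I ideal stable L sortedN

  partA : Linked (λ B B′ → l L (suc m) B′ < l L (suc m) B) (bars L (2 + m))
  partA = AllPairs⇒Linked (bars-allPairs (2 + m) λ barB barB′ B≺B′ →
            l-decreasing m ≤-refl barB barB′ B≺B′ (AgreeFrom-beyond _ _))

  partB : ∀ i → 1 ≤ i → i ≤ m → ∀ B → B ∈ bars L (i + 2) →
          Linked (λ C C′ → l L i C′ < l L i C) (barsOver L (i + 1) B)
  partB (suc u) _ i≤m B B∈ rewrite +-comm u 1 =
    AllPairs⇒Linked (barsOver-allPairs (2 + u) B λ barC barC′ C⊑B C′⊑B C≺C′ →
      l-decreasing u (s≤s (m≤n⇒m≤1+n i≤m)) barC barC′ C≺C′
        (AgreeFrom-trans (⊑-agree barB barC C⊑B) (AgreeFrom-sym (⊑-agree barB barC′ C′⊑B))))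
    where
    barB : IsBar (3 + u) B
    barB = All.lookup (bars-IsBar (3 + u)) (subst (λ k → B ∈ bars L (suc k)) (+-comm u 2) B∈)
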